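{- Let $p, c_1, c_2, c_3$ be positive integers and let $X_1, X_2, X_3$ be integers with $|X_i| < c_i p$ for each $i \in \{1,2,3\}$. Set $Q = \sum_{i=1}^3 c_i X_i^2$ and $C = \sum_{i=1}^3 c_i^3$. Then $2Cp^3 + 6pQ$ is the sum of the cubes of six positive integers. -}

module Defs where

open import Data.Integer using (ℤ; _*_)

cube : ℤ → ℤ
cube x = x * x * x

-- The proof rests on the identity
--     (a + x)³ + (a − x)³ = 2a³ + 6ax²,
-- applied with a = cᵢ p and x = Xᵢ, which turns each summand
-- 2cᵢ³p³ + 6p·cᵢXᵢ² of the left-hand side into a sum of two cubes.
-- The hypothesis |Xᵢ| < cᵢ p guarantees that both bases cᵢ p ± Xᵢ are
-- positive.
module Submission where

open import Defs
open import Data.Integer using (ℤ; +_; _+_; _*_; _<_; ∣_∣; -_; _-_; _≤_; +≤+; -[1+_])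
open import Data.Integer.Properties using (≤-<-trans; +-monoˡ-<; ∣-i∣≡∣i∣; n⊖n≡0)
open import Data.Integer.Tactic.RingSolver using (solve-∀)
open import Data.Nat using (suc; z≤n)
open import Data.Product using (Σ; _×_; _,_)
open import Relation.Binary.PropositionalEquality using (_≡_; subst; sym; cong₂)
open Relation.Binary.PropositionalEquality.≡-Reasoning

abs-plus-self-nonneg : ∀ X → + 0 ≤ + ∣ X ∣ + X
abs-plus-self-nonneg (+ n)    = +≤+ z≤n
abs-plus-self-nonneg -[1+ n ] rewrite n⊖n≡0 (suc n) = +≤+ z≤n

-- If |X| < a then a + X is positive: 0 ≤ |X| + X < a + X.
plus-pos : ∀ a X → + ∣ X ∣ < a → + 0 < a + X
plus-pos a X |X|<a = ≤-<-trans (abs-plus-self-nonneg X) (+-monoˡ-< X |X|<a)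

minus-pos : ∀ a X → + ∣ X ∣ < a → + 0 < a - X
minus-pos a X |X|<a =
  plus-pos a (- X) (subst (λ k → + k < a) (sym (∣-i∣≡∣i∣ X)) |X|<a)

-- The two-cube identity (a + x)³ + (a − x)³ = 2a³ + 6ax², written with
-- a = c p so that the right-hand side has the shape of one summand of
-- the theorem: 2c³p³ + 6p·cx².  (Cubes are written out as products,
-- which is definitionally cube, so that the ring solver can read them.)
cube-pair : ∀ c p x →
  (c * p + x) * (c * p + x) * (c * p + x) + (c * p - x) * (c * p - x) * (c * p - x)
  ≡ + 2 * (c * c * c) * (p * p * p) + + 6 * p * (c * (x * x))
cube-pair = solve-∀

regroup : ∀ c₁ c₂ c₃ p x₁ x₂ x₃ →
  + 2 * (c₁ * c₁ * c₁ + c₂ * c₂ * c₂ + c₃ * c₃ * c₃) * (p * p * p)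
    + + 6 * p * (c₁ * (x₁ * x₁) + c₂ * (x₂ * x₂) + c₃ * (x₃ * x₃))
  ≡ (+ 2 * (c₁ * c₁ * c₁) * (p * p * p) + + 6 * p * (c₁ * (x₁ * x₁)))
    + (+ 2 * (c₂ * c₂ * c₂) * (p * p * p) + + 6 * p * (c₂ * (x₂ * x₂)))
    + (+ 2 * (c₃ * c₃ * c₃) * (p * p * p) + + 6 * p * (c₃ * (x₃ * x₃)))
regroup = solve-∀

flatten : ∀ a b c d e f → (a + b) + (c + d) + (e + f) ≡ a + b + c + d + e + f
flatten = solve-∀

mainTheorem3 : (p c₁ c₂ c₃ : ℤ) (X₁ X₂ X₃ : ℤ) →
    + 0 < p → + 0 < c₁ → + 0 < c₂ → + 0 < c₃ →
    + ∣ X₁ ∣ < c₁ * p → + ∣ X₂ ∣ < c₂ * p → + ∣ X₃ ∣ < c₃ * p →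
    Σ ℤ λ y₁ → Σ ℤ λ y₂ → Σ ℤ λ y₃ → Σ ℤ λ y₄ → Σ ℤ λ y₅ → Σ ℤ λ y₆ →
    (+ 0 < y₁) × (+ 0 < y₂) × (+ 0 < y₃) × (+ 0 < y₄) × (+ 0 < y₅) × (+ 0 < y₆) ×
    (+ 2 * (cube c₁ + cube c₂ + cube c₃) * (p * p * p)
    + + 6 * p * (c₁ * (X₁ * X₁) + c₂ * (X₂ * X₂) + c₃ * (X₃ * X₃))
    ≡ cube y₁ + cube y₂ + cube y₃ + cube y₄ + cube y₅ + cube y₆)
mainTheorem3 p c₁ c₂ c₃ X₁ X₂ X₃ _ _ _ _ h₁ h₂ h₃ =
  c₁ * p + X₁ , c₁ * p - X₁ , c₂ * p + X₂ , c₂ * p - X₂ , c₃ * p + X₃ , c₃ * p - X₃ ,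
  plus-pos _ X₁ h₁ , minus-pos _ X₁ h₁ ,
  plus-pos _ X₂ h₂ , minus-pos _ X₂ h₂ ,
  plus-pos _ X₃ h₃ , minus-pos _ X₃ h₃ ,
  sum-of-cubes
  where
  sum-of-cubes :
    + 2 * (cube c₁ + cube c₂ + cube c₃) * (p * p * p)
      + + 6 * p * (c₁ * (X₁ * X₁) + c₂ * (X₂ * X₂) + c₃ * (X₃ * X₃))
    ≡ cube (c₁ * p + X₁) + cube (c₁ * p - X₁) + cube (c₂ * p + X₂)
      + cube (c₂ * p - X₂) + cube (c₃ * p + X₃) + cube (c₃ * p - X₃)
  sum-of-cubes = begin
    _ ≡⟨ regroup c₁ c₂ c₃ p X₁ X₂ X₃ ⟩
    _ ≡⟨ cong₂ _+_ (cong₂ _+_ (sym (cube-pair c₁ p X₁)) (sym (cube-pair c₂ p X₂)))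
                   (sym (cube-pair c₃ p X₃)) ⟩
    _ ≡⟨ flatten (cube (c₁ * p + X₁)) (cube (c₁ * p - X₁)) (cube (c₂ * p + X₂))
                 (cube (c₂ * p - X₂)) (cube (c₃ * p + X₃)) (cube (c₃ * p - X₃)) ⟩
    _ ∎
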